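{- For any Boolean matrices $K \in \{0,1\}^{m_1\times n_1}$ and $M \in \{0,1\}^{m_2\times n_2}$, and for $\mathsf{L}\in\{\mathsf{OR},\mathsf{SUM}\}$, we have $\mathsf{L}(K\otimes M) \ge \mathsf{rk_\lor}(K)\cdot \mathsf{L}(M) / (1 + \log m_1 n_1)$.
   Context: $\log$ denotes the binary logarithm. The Kronecker product $K\otimes M$ is the $(m_1m_2)\times(n_1n_2)$ Boolean matrix with rows indexed by pairs $(i_1,i_2)$, columns by pairs $(j_1,j_2)$, and entry $K_{i_1,j_1}\cdot M_{i_2,j_2}$. A rectifier network with $m$ inputs and $n$ outputs is a tuple $(V,E,\mathsf{in},\mathsf{out})$ where $(V,E)$ is a directed acyclic graph and $\mathsf{in}\colon\{1,\dots,n\}\to V$, $\mathsf{out}\colon\{1,\dots,m\}\to V$ are injective maps whose images consist only of sources (respectively, only of sinks); its size is $|E|$; it expresses the Boolean $m\times n$ matrix with entry $(i,j)$ equal to $1$ iff there is a directed path from $\mathsf{in}(j)$ to $\mathsf{out}(i)$. It is unambiguous if for all $i,j$ there is at most one path from $\mathsf{in}(j)$ to $\mathsf{out}(i)$. $\mathsf{OR}(A)$ is the smallest size of a rectifier network expressing $A$, and $\mathsf{SUM}(A)$ the smallest size of an unambiguous rectifier network expressing $A$. The Boolean rank $\mathsf{rk_\lor}(K)$ is the smallest number of all-$1$ submatrices $R\times C$ of $K$ whose union contains all $1$-entries of $K$. -}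

module Defs where

open import Data.Nat using (ℕ; zero; suc; _+_; _*_; _≤_)
open import Data.Bool using (Bool; true; false; _∧_; T)
open import Data.Fin using (Fin; zero; suc; remQuot)
open import Data.Product using (Σ; ∃; _×_; _,_; proj₁; proj₂)
open import Data.Unit using (⊤)
open import Relation.Nullary using (¬_)
open import Relation.Binary.PropositionalEquality using (_≡_)
open import Function.Definitions using (Injective)

Mat : ℕ → ℕ → Set
Mat m n = Fin m → Fin n → Bool

-- Kronecker product; row index of K ⊗ M in Fin (m₁ * m₂) is decoded as the
-- pair (i₁ , i₂) via remQuot (lexicographic order), similarly for columns.
_⊗_ : ∀ {m₁ n₁ m₂ n₂} → Mat m₁ n₁ → Mat m₂ n₂ → Mat (m₁ * m₂) (n₁ * n₂)
_⊗_ {m₁} {n₁} {m₂} {n₂} K M i j =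
  K (proj₁ (remQuot {m₁} m₂ i)) (proj₁ (remQuot {n₁} n₂ j))
  ∧ M (proj₂ (remQuot {m₁} m₂ i)) (proj₂ (remQuot {n₁} n₂ j))

∑ : (n : ℕ) → (Fin n → ℕ) → ℕ
∑ zero    f = 0
∑ (suc n) f = f zero + ∑ n (λ i → f (suc i))

count : Bool → ℕ
count true  = 1
count false = 0

data Path {v : ℕ} (E : Fin v → Fin v → Bool) : Fin v → Fin v → Set where
  []  : ∀ {u} → Path E u u
  _∷_ : ∀ {u w x} → T (E u w) → Path E w x → Path E u x

record Network (m n : ℕ) : Set where
  field
    v        : ℕ
    E        : Fin v → Fin v → Bool
    acyclic  : ∀ u w → T (E u w) → ¬ Path E w u
    inp      : Fin n → Fin v
    out      : Fin m → Fin v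
    inp-inj  : Injective _≡_ _≡_ inp
    out-inj  : Injective _≡_ _≡_ out
    inp-src  : ∀ j u → E u (inp j) ≡ false
    out-sink : ∀ i u → E (out i) u ≡ false

open Network public

size : ∀ {m n} → Network m n → ℕ
size N = ∑ (v N) (λ u → ∑ (v N) (λ w → count (E N u w)))

Expresses : ∀ {m n} → Network m n → Mat m n → Set
Expresses N A = ∀ i j →
  (T (A i j) → Path (E N) (inp N j) (out N i)) × (Path (E N) (inp N j) (out N i) → T (A i j))

Unambiguous : ∀ {m n} → Network m n → Set
Unambiguous N = ∀ i j → (p q : Path (E N) (inp N j) (out N i)) → p ≡ q

data Measure : Set where
  OR SUM : Measure

Admissible : Measure → ∀ {m n} → Network m n → Set
Admissible OR  N = ⊤
Admissible SUM N = Unambiguous N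

IsComplexity : Measure → ∀ {m n} → Mat m n → ℕ → Set
IsComplexity L {m} {n} A k =
  (Σ (Network m n) λ N → Admissible L N × Expresses N A × size N ≡ k)
  × (∀ (N : Network m n) → Admissible L N → Expresses N A → k ≤ size N)

HasRectCover : ∀ {m n} → Mat m n → ℕ → Set
HasRectCover {m} {n} K r =
  Σ (Fin r → (Fin m → Bool) × (Fin n → Bool)) λ RC →
    (∀ t i j → T (proj₁ (RC t) i) → T (proj₂ (RC t) j) → T (K i j))
    × (∀ i j → T (K i j) → ∃ λ t → T (proj₁ (RC t) i) × T (proj₂ (RC t) j))

IsBoolRank : ∀ {m n} → Mat m n → ℕ → Set
IsBoolRank K r = HasRectCover K r × (∀ r' → HasRectCover K r' → r ≤ r')

-- A network N of size a for K ⊗ M assigns to each edge (u, w) the rectangle of those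
-- (i, j) for which u is reachable from an input of column block j and w reaches an output
-- of row block i; this rectangle lies inside K. Restricting N to the edges whose rectangle
-- contains (i, j) gives a network for M whenever K i j = 1, so every 1-entry of K lies in
-- at least b = L(M) of the a rectangles. Greedily picking the rectangle that covers most
-- of the still uncovered entries multiplies their number by at most 1 - b/a ≤ 2^(-b/a),
-- so some c ≤ a (1 + log m₁n₁) / b of the rectangles cover K.
module Submission where

open import Defs
open import Data.Nat
open import Data.Nat.Properties
open import Data.Nat.Tactic.RingSolver using (solve-∀)
open import Data.Bool using (Bool; true; false; _∧_; not; T)
open import Data.Bool.Properties using (T-∧; T-irrelevant)
open import Data.Empty using (⊥-elim)
open import Data.Fin using (Fin; zero; suc; combine; remQuot; _↑ˡ_; _↑ʳ_; splitAt)
open import Data.Fin.Properties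
  using ( ¬Fin0; any?; injective⇒≤; remQuot-combine; combine-injectiveʳ
        ; ↑ˡ-injective; ↑ʳ-injective; splitAt-↑ˡ; splitAt-↑ʳ)
  renaming (_≟_ to _≟ᶠ_)
open import Data.Product using (Σ; ∃; _×_; _,_; proj₁; proj₂; map₂; uncurry)
open import Data.Sum using (_⊎_; inj₁; inj₂)
open import Data.Unit using (tt)
open import Function using (_∘_; Equivalence)
open import Function.Definitions using (Injective)
open import Relation.Binary.PropositionalEquality
open import Relation.Nullary using (Dec; yes; no; ¬_; contradiction)
open import Relation.Nullary.Decidable using (⌊_⌋; T?; map′; _×-dec_; toWitness; fromWitness)
open import Algebra.Properties.CommutativeSemigroup *-commutativeSemigroup using (x∙yz≈y∙xz; interchange)
open import Algebra.Properties.CommutativeMonoid.Sum +-0-commutativeMonoid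
  using (sum; sum-syntax; sum-cong-≗; ∑-comm; ∑-distrib-+; sum-replicate-zero)
open import Algebra.Properties.Semiring.Sum +-*-semiring using (*-distribˡ-sum; *-distribʳ-sum)

^-distribʳ-* : ∀ m n k → (m * n) ^ k ≡ m ^ k * n ^ k
^-distribʳ-* m n zero    = refl
^-distribʳ-* m n (suc k) = begin
  m * n * (m * n) ^ k     ≡⟨ cong (m * n *_) (^-distribʳ-* m n k) ⟩
  m * n * (m ^ k * n ^ k) ≡⟨ interchange m n (m ^ k) (n ^ k) ⟩
  m ^ suc k * n ^ suc k   ∎
  where open ≡-Reasoning

m^[1+n]+[1+n]*m^n≤[1+m]^[1+n] : ∀ m n → m ^ suc n + suc n * m ^ n ≤ suc m ^ suc n
m^[1+n]+[1+n]*m^n≤[1+m]^[1+n] m zero    = ≤-reflexive (+-comm (m * 1) 1)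
m^[1+n]+[1+n]*m^n≤[1+m]^[1+n] m (suc n) = begin
  m * (m * x) + suc (suc n) * (m * x)             ≤⟨ m≤m+n _ (suc n * x) ⟩
  m * (m * x) + suc (suc n) * (m * x) + suc n * x ≡⟨ regroup m n x ⟩
  suc m * (m * x + suc n * x)                     ≤⟨ *-monoʳ-≤ (suc m) (m^[1+n]+[1+n]*m^n≤[1+m]^[1+n] m n) ⟩
  suc m ^ suc (suc n)                             ∎
  where
  open ≤-Reasoning
  x = m ^ n
  regroup : ∀ m n x → m * (m * x) + (2 + n) * (m * x) + (1 + n) * x ≡ (1 + m) * (m * x + (1 + n) * x)
  regroup = solve-∀

2*m^n≤[1+m]^n : ∀ {m n} → m < n → 2 * m ^ n ≤ suc m ^ n
2*m^n≤[1+m]^n {m} m<n with k , refl ← m≤n⇒∃[o]m+o≡n m<n = begin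
  2 * m ^ (suc m + k)                 ≡⟨ cong (2 *_) (^-distribˡ-+-* m (suc m) k) ⟩
  2 * (m ^ suc m * m ^ k)             ≡⟨ *-assoc 2 (m ^ suc m) (m ^ k) ⟨
  2 * m ^ suc m * m ^ k               ≤⟨ *-mono-≤ twice (^-monoˡ-≤ k (n≤1+n m)) ⟩
  suc m ^ suc m * suc m ^ k           ≡⟨ ^-distribˡ-+-* (suc m) (suc m) k ⟨
  suc m ^ (suc m + k)                 ∎
  where
  open ≤-Reasoning
  twice : 2 * m ^ suc m ≤ suc m ^ suc m
  twice = begin
    m ^ suc m + (m ^ suc m + 0) ≡⟨ cong (m ^ suc m +_) (+-identityʳ _) ⟩
    m ^ suc m + m * m ^ m       ≤⟨ +-monoʳ-≤ (m ^ suc m) (*-monoˡ-≤ (m ^ m) (n≤1+n m)) ⟩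
    m ^ suc m + suc m * m ^ m   ≤⟨ m^[1+n]+[1+n]*m^n≤[1+m]^[1+n] m m ⟩
    suc m ^ suc m               ∎

-- (1 - b/a)^a ≤ 2^-b, cleared of denominators (d = a - b)
2^b*d^a≤a^a : ∀ a b d → b + d ≡ a → 2 ^ b * d ^ a ≤ a ^ a
2^b*d^a≤a^a a zero    d refl   = ≤-reflexive (+-identityʳ (d ^ d))
2^b*d^a≤a^a a (suc b) d b+d≡a = begin
  2 * 2 ^ b * d ^ a   ≡⟨ cong (_* d ^ a) (*-comm 2 (2 ^ b)) ⟩
  2 ^ b * 2 * d ^ a   ≡⟨ *-assoc (2 ^ b) 2 (d ^ a) ⟩
  2 ^ b * (2 * d ^ a) ≤⟨ *-monoʳ-≤ (2 ^ b) (2*m^n≤[1+m]^n d<a) ⟩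
  2 ^ b * suc d ^ a   ≤⟨ 2^b*d^a≤a^a a b (suc d) (trans (+-suc b d) b+d≡a) ⟩
  a ^ a               ∎
  where
  open ≤-Reasoning
  d<a : d < a
  d<a = subst (d <_) b+d≡a (s≤s (m≤n+m d b))

2^b*u′^a≤u^a : ∀ {a b u u′} → b ≤ a → 0 < a → a * u′ ≤ (a ∸ b) * u → 2 ^ b * u′ ^ a ≤ u ^ a
2^b*u′^a≤u^a {a} {b} {u} {u′} b≤a a>0 shrink = *-cancelˡ-≤ (a ^ a) {{m^n≢0 a a {{>-nonZero a>0}}}} (begin
  a ^ a * (2 ^ b * u′ ^ a)       ≡⟨ x∙yz≈y∙xz (a ^ a) (2 ^ b) (u′ ^ a) ⟩
  2 ^ b * (a ^ a * u′ ^ a)       ≡⟨ cong (2 ^ b *_) (^-distribʳ-* a u′ a) ⟨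
  2 ^ b * (a * u′) ^ a           ≤⟨ *-monoʳ-≤ (2 ^ b) (^-monoˡ-≤ a shrink) ⟩
  2 ^ b * ((a ∸ b) * u) ^ a      ≡⟨ cong (2 ^ b *_) (^-distribʳ-* (a ∸ b) u a) ⟩
  2 ^ b * ((a ∸ b) ^ a * u ^ a)  ≡⟨ *-assoc (2 ^ b) _ (u ^ a) ⟨
  2 ^ b * (a ∸ b) ^ a * u ^ a    ≤⟨ *-monoˡ-≤ (u ^ a) (2^b*d^a≤a^a a b (a ∸ b) (m+[n∸m]≡n b≤a)) ⟩
  a ^ a * u ^ a                  ∎)
  where open ≤-Reasoning

greedy-bound-step : ∀ {a b c u u′} → b ≤ a → 0 < a → 0 < u → a * u′ ≤ (a ∸ b) * u →
  c ≡ 0 ⊎ 2 ^ (c * b) ≤ 2 ^ a * u′ ^ a → 2 ^ (suc c * b) ≤ 2 ^ a * u ^ a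
greedy-bound-step {a} {b} {u = u} b≤a _ u>0 _ (inj₁ refl) = begin
  2 ^ (b + 0)   ≡⟨ cong (2 ^_) (+-identityʳ b) ⟩
  2 ^ b         ≤⟨ ^-monoʳ-≤ 2 b≤a ⟩
  2 ^ a         ≡⟨ *-identityʳ (2 ^ a) ⟨
  2 ^ a * 1     ≤⟨ *-monoʳ-≤ (2 ^ a) (m^n>0 u {{>-nonZero u>0}} a) ⟩
  2 ^ a * u ^ a ∎
  where open ≤-Reasoning
greedy-bound-step {a} {b} {c} {u} {u′} b≤a a>0 _ shrink (inj₂ IH) = begin
  2 ^ (b + c * b)             ≡⟨ ^-distribˡ-+-* 2 b (c * b) ⟩
  2 ^ b * 2 ^ (c * b)         ≤⟨ *-monoʳ-≤ (2 ^ b) IH ⟩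
  2 ^ b * (2 ^ a * u′ ^ a)    ≡⟨ x∙yz≈y∙xz (2 ^ b) (2 ^ a) (u′ ^ a) ⟩
  2 ^ a * (2 ^ b * u′ ^ a)    ≤⟨ *-monoʳ-≤ (2 ^ a) (2^b*u′^a≤u^a b≤a a>0 shrink) ⟩
  2 ^ a * u ^ a               ∎
  where open ≤-Reasoning

∑≡sum : ∀ n (f : Fin n → ℕ) → ∑ n f ≡ sum f
∑≡sum zero    f = refl
∑≡sum (suc n) f = cong (f zero +_) (∑≡sum n (f ∘ suc))

sum-mono-≤ : ∀ {n} {f g : Fin n → ℕ} → (∀ i → f i ≤ g i) → sum f ≤ sum g
sum-mono-≤ {zero}  f≤g = z≤n
sum-mono-≤ {suc n} f≤g = +-mono-≤ (f≤g zero) (sum-mono-≤ (f≤g ∘ suc))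

sum-↑ : ∀ m n (f : Fin (m + n) → ℕ) → sum f ≡ sum (f ∘ (_↑ˡ n)) + sum (f ∘ (m ↑ʳ_))
sum-↑ zero    n f = refl
sum-↑ (suc m) n f = trans (cong (f zero +_) (sum-↑ m n (f ∘ suc))) (sym (+-assoc (f zero) _ _))

sum-combine : ∀ m n (f : Fin (m * n) → ℕ) → sum f ≡ ∑[ i < m ] ∑[ j < n ] f (combine i j)
sum-combine zero    n f = refl
sum-combine (suc m) n f = begin
  sum f                                              ≡⟨ sum-↑ n (m * n) f ⟩
  first + sum (f ∘ (n ↑ʳ_))                          ≡⟨ cong (first +_) (sum-combine m n (f ∘ (n ↑ʳ_))) ⟩
  first + ∑[ i < m ] ∑[ j < n ] f (n ↑ʳ combine i j) ∎
  where
  open ≡-Reasoning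
  first = sum (f ∘ (_↑ˡ m * n))

argmax : ∀ {n} (f : Fin (suc n) → ℕ) → ∃ λ i → ∀ j → f j ≤ f i
argmax {zero}  f = zero , λ { zero → ≤-refl }
argmax {suc n} f with argmax (f ∘ suc)
... | i , max with f zero ≤? f (suc i)
...   | yes f₀≤ = suc i , λ { zero → f₀≤ ; (suc j) → max j }
...   | no  f₀≰ = zero  , λ { zero → ≤-refl ; (suc j) → ≤-trans (max j) (<⇒≤ (≰⇒> f₀≰)) }

_∩_ _∖_ : ∀ {n} → (Fin n → Bool) → (Fin n → Bool) → Fin n → Bool
(U ∩ V) x = U x ∧ V x
(U ∖ V) x = U x ∧ not (V x)

card : ∀ {n} → (Fin n → Bool) → ℕ
card U = sum (count ∘ U)

∑∑count≡card : ∀ m n (g : Fin m → Fin n → Bool) →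
  ∑ m (λ i → ∑ n (λ j → count (g i j))) ≡ card (uncurry g ∘ remQuot n)
∑∑count≡card m n g = begin
  ∑ m (λ i → ∑ n (λ j → count (g i j)))                             ≡⟨ ∑≡sum m _ ⟩
  ∑[ i < m ] ∑ n (λ j → count (g i j))                              ≡⟨ sum-cong-≗ {m} inner ⟩
  ∑[ i < m ] ∑[ j < n ] count (g i j)                               ≡⟨ sum-cong-≗ {m} decode ⟨
  ∑[ i < m ] ∑[ j < n ] count (uncurry g (remQuot n (combine i j))) ≡⟨ sum-combine m n _ ⟨
  card (uncurry g ∘ remQuot n)                                      ∎
  where
  open ≡-Reasoning
  inner : ∀ i → ∑ n (λ j → count (g i j)) ≡ ∑[ j < n ] count (g i j)
  inner i = ∑≡sum n (λ j → count (g i j))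
  decode : ∀ i → ∑[ j < n ] count (uncurry g (remQuot n (combine i j))) ≡ ∑[ j < n ] count (g i j)
  decode i = sum-cong-≗ {n} λ j → cong (count ∘ uncurry g) (remQuot-combine i j)

card≤n : ∀ {n} (U : Fin n → Bool) → card U ≤ n
card≤n {zero}  U = z≤n
card≤n {suc n} U = +-mono-≤ (count≤1 (U zero)) (card≤n (U ∘ suc))
  where
  count≤1 : ∀ x → count x ≤ 1
  count≤1 true  = ≤-refl
  count≤1 false = z≤n

card-mono : ∀ {n} {U V : Fin n → Bool} → (∀ x → T (U x) → T (V x)) → card U ≤ card V
card-mono {U = U} {V} U⊆V = sum-mono-≤ (λ x → count-mono (U x) (V x) (U⊆V x))
  where
  count-mono : ∀ u v → (T u → T v) → count u ≤ count v
  count-mono false v       _   = z≤n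
  count-mono true  true    _   = ≤-refl
  count-mono true  false u⇒v = ⊥-elim (u⇒v _)

card-∅ : ∀ {n} (U : Fin n → Bool) → (∀ x → ¬ T (U x)) → card U ≡ 0
card-∅ {n} U ∅ =
  n≤0⇒n≡0 (≤-trans (card-mono {V = λ _ → false} ∅) (≤-reflexive (sum-replicate-zero n)))

card>0 : ∀ {n} (U : Fin n → Bool) {x} → T (U x) → 0 < card U
card>0 U {zero}  x∈U with U zero
... | true = s≤s z≤n
card>0 U {suc x} x∈U = ≤-trans (card>0 (U ∘ suc) x∈U) (m≤n+m _ (count (U zero)))

card-∖-∩ : ∀ {n} (U V : Fin n → Bool) → card U ≡ card (U ∖ V) + card (U ∩ V)
card-∖-∩ U V =
  trans (sum-cong-≗ (λ x → split (U x) (V x))) (∑-distrib-+ (count ∘ (U ∖ V)) (count ∘ (U ∩ V)))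
  where
  split : ∀ u v → count u ≡ count (u ∧ not v) + count (u ∧ v)
  split false v     = refl
  split true  true  = refl
  split true  false = refl

∃-term≥average : ∀ {n} (f : Fin n → ℕ) (live : Fin n → Bool) → (∀ i → live i ≡ false → f i ≡ 0) →
  0 < sum f → ∃ λ i → sum f ≤ card live * f i
∃-term≥average {zero}  f live dead⇒0 ()
∃-term≥average {suc n} f live dead⇒0 _ with argmax f
... | i , max = i , (begin
  sum f                                 ≤⟨ sum-mono-≤ bounded ⟩
  ∑[ j < suc n ] (count (live j) * f i) ≡⟨ *-distribʳ-sum (f i) (count ∘ live) ⟨
  card live * f i                       ∎)
  where
  open ≤-Reasoning
  bounded : ∀ j → f j ≤ count (live j) * f i
  bounded j with live j in lj
  ... | true  = ≤-trans (max j) (≤-reflexive (sym (+-identityʳ (f i))))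
  ... | false = ≤-reflexive (dead⇒0 j lj)

-- Greedy set cover

module GreedyCover {P Q : ℕ} (S : Fin P → Fin Q → Bool) (live : Fin P → Bool)
                   (S⊆live : ∀ e x → T (S e x) → T (live e)) {b : ℕ} (b>0 : 0 < b) where

  a : ℕ
  a = card live

  deg : Fin Q → ℕ
  deg x = card (λ e → S e x)

  Multicovered : (Fin Q → Bool) → Set
  Multicovered U = ∀ x → T (U x) → b ≤ deg x

  record Cover (U : Fin Q → Bool) : Set where
    field
      #sets  : ℕ
      sets   : Fin #sets → Fin P
      covers : ∀ x → T (U x) → ∃ λ t → T (S (sets t) x)
      -- that is, #sets ≤ a (1 + log (card U)) / b
      bound  : #sets ≡ 0 ⊎ 2 ^ (#sets * b) ≤ 2 ^ a * card U ^ a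

  double-counting : ∀ U → Multicovered U → b * card U ≤ ∑[ e < P ] card (U ∩ S e)
  double-counting U mult = begin
    b * card U                                   ≡⟨ *-distribˡ-sum b (count ∘ U) ⟩
    ∑[ x < Q ] (b * count (U x))                 ≤⟨ sum-mono-≤ pointwise ⟩
    ∑[ x < Q ] ∑[ e < P ] count (U x ∧ S e x)    ≡⟨ ∑-comm (λ x e → count (U x ∧ S e x)) ⟩
    ∑[ e < P ] card (U ∩ S e)                    ∎
    where
    open ≤-Reasoning
    pointwise : ∀ x → b * count (U x) ≤ ∑[ e < P ] count (U x ∧ S e x)
    pointwise x with U x in Ux
    ... | true  = ≤-trans (≤-reflexive (*-identityʳ b)) (mult x (subst T (sym Ux) _))
    ... | false = ≤-trans (≤-reflexive (*-zeroʳ b)) z≤n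

  heaviest-set : ∀ {U x} → T (U x) → Multicovered U → ∃ λ e → b * card U ≤ a * card (U ∩ S e)
  heaviest-set {U} x∈U mult =
    map₂ (≤-trans (double-counting U mult)) (∃-term≥average (λ e → card (U ∩ S e)) live dead⇒0 total>0)
    where
    dead⇒0 : ∀ e → live e ≡ false → card (U ∩ S e) ≡ 0
    dead⇒0 e dead = card-∅ (U ∩ S e) λ x x∈U∩Se →
      subst T dead (S⊆live e x (proj₂ (Equivalence.to T-∧ x∈U∩Se)))
    total>0 : 0 < ∑[ e < P ] card (U ∩ S e)
    total>0 = ≤-trans (*-mono-≤ b>0 (card>0 U x∈U)) (double-counting U mult)

  extend : ∀ {U x e} → T (U x) → Multicovered U → b * card U ≤ a * card (U ∩ S e) →
           Cover (U ∖ S e) → Cover U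
  extend {U} {x} {e} x∈U mult heavy C = record
    { #sets  = suc #sets
    ; sets   = sets′
    ; covers = covers′
    ; bound  = inj₂ (greedy-bound-step b≤a (≤-trans b>0 b≤a) (card>0 U x∈U) shrink bound)
    }
    where
    open Cover C
    u′ = card (U ∖ S e)
    b≤a : b ≤ a
    b≤a = ≤-trans (mult x x∈U) (card-mono (λ e → S⊆live e x))
    a*u′+b*u≤a*u : a * u′ + b * card U ≤ a * card U
    a*u′+b*u≤a*u = begin
      a * u′ + b * card U                ≤⟨ +-monoʳ-≤ (a * u′) heavy ⟩
      a * u′ + a * card (U ∩ S e)        ≡⟨ *-distribˡ-+ a u′ _ ⟨
      a * (u′ + card (U ∩ S e))          ≡⟨ cong (a *_) (card-∖-∩ U (S e)) ⟨
      a * card U                         ∎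
      where open ≤-Reasoning
    shrink : a * u′ ≤ (a ∸ b) * card U
    shrink = subst (a * u′ ≤_) (sym (*-distribʳ-∸ (card U) a b)) (m+n≤o⇒m≤o∸n (a * u′) a*u′+b*u≤a*u)
    sets′ : Fin (suc #sets) → Fin P
    sets′ zero    = e
    sets′ (suc t) = sets t
    covers′ : ∀ y → T (U y) → ∃ λ t → T (S (sets′ t) y)
    covers′ y y∈U with S e y in Sey
    ... | true  = zero , subst T (sym Sey) _
    ... | false = let t , y∈St = covers y (Equivalence.from T-∧ (y∈U , subst (T ∘ not) (sym Sey) _))
                  in suc t , y∈St

  greedy : ∀ {k} U → card U ≤ k → Multicovered U → Cover U
  greedy U _ _ with any? (λ x → T? (U x))
  ... | no ∄x =
    record { #sets = 0 ; sets = λ () ; covers = λ x x∈U → ⊥-elim (∄x (x , x∈U)) ; bound = inj₁ refl }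
  greedy {zero}  U u≤0 _    | yes (x , x∈U) = contradiction u≤0 (<⇒≱ (card>0 U x∈U))
  greedy {suc k} U u≤k mult | yes (x , x∈U) with heaviest-set x∈U mult
  ... | e , heavy = extend x∈U mult heavy
                      (greedy (U ∖ S e) u′≤k (λ y y∈U′ → mult y (proj₁ (Equivalence.to T-∧ y∈U′))))
    where
    s>0 : 0 < card (U ∩ S e)
    s>0 = n≢0⇒n>0 λ s≡0 → <⇒≱ (≤-trans (*-mono-≤ b>0 (card>0 U x∈U)) heavy)
                              (≤-reflexive (trans (cong (a *_) s≡0) (*-zeroʳ a)))
    u′≤k : card (U ∖ S e) ≤ k
    u′≤k = s≤s⁻¹ (≤-trans (subst (card (U ∖ S e) <_) (sym (card-∖-∩ U (S e))) (m<m+n _ s>0)) u≤k)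

  greedy-cover : ∀ U → Multicovered U → Cover U
  greedy-cover U = greedy U ≤-refl

inRect : ∀ {m n} → (Fin m → Bool) × (Fin n → Bool) → Fin m → Fin n → Bool
inRect (R , C) i j = R i ∧ C j

module _ {m n P : ℕ} (K : Mat m n) (rect : Fin P → (Fin m → Bool) × (Fin n → Bool))
         (live : Fin P → Bool) (rect-live : ∀ e i j → T (inRect (rect e) i j) → T (live e))
         (rect⊆K : ∀ e i j → T (inRect (rect e) i j) → T (K i j)) where

  multicover⇒cover : ∀ {b} → 0 < b → (∀ i j → T (K i j) → b ≤ card (λ e → inRect (rect e) i j)) →
    0 < m * n → ∃ λ c → HasRectCover K c × 2 ^ (c * b) ≤ (2 * (m * n)) ^ card live
  multicover⇒cover {b} b>0 multi mn>0 = #sets , (rect ∘ sets , valid , covered) , relax bound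
    where
    S : Fin P → Fin (m * n) → Bool
    S e = uncurry (inRect (rect e)) ∘ remQuot n
    U : Fin (m * n) → Bool
    U = uncurry K ∘ remQuot n
    open GreedyCover S live (λ e x → rect-live e _ _) b>0
    open Cover (greedy-cover U (λ x → multi _ _))
    valid : ∀ t i j → T (proj₁ (rect (sets t)) i) → T (proj₂ (rect (sets t)) j) → T (K i j)
    valid t i j i∈R j∈C = rect⊆K (sets t) i j (Equivalence.from T-∧ (i∈R , j∈C))
    covered : ∀ i j → T (K i j) → ∃ λ t → T (proj₁ (rect (sets t)) i) × T (proj₂ (rect (sets t)) j)
    covered i j Kij =
      let t , ij∈t = covers (combine i j) (subst (T ∘ uncurry K) (sym (remQuot-combine i j)) Kij)
      in t , Equivalence.to T-∧ (subst (T ∘ uncurry (inRect (rect (sets t)))) (remQuot-combine i j) ij∈t)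
    relax : ∀ {c} → c ≡ 0 ⊎ 2 ^ (c * b) ≤ 2 ^ a * card U ^ a → 2 ^ (c * b) ≤ (2 * (m * n)) ^ a
    relax (inj₁ refl) = m^n>0 (2 * (m * n)) {{>-nonZero (*-monoʳ-< 2 mn>0)}} a
    relax {c} (inj₂ greedy-bound) = begin
      2 ^ (c * b)             ≤⟨ greedy-bound ⟩
      2 ^ a * card U ^ a      ≤⟨ *-monoʳ-≤ (2 ^ a) (^-monoˡ-≤ a (card≤n U)) ⟩
      2 ^ a * (m * n) ^ a     ≡⟨ ^-distribʳ-* 2 (m * n) a ⟨
      (2 * (m * n)) ^ a       ∎
      where open ≤-Reasoning

-- Paths in acyclic graphs

module _ {v : ℕ} {E : Fin v → Fin v → Bool} where

  length : ∀ {x y} → Path E x y → ℕ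
  length []      = 0
  length (_ ∷ p) = suc (length p)

  infixr 5 _++_
  _++_ : ∀ {x y z} → Path E x y → Path E y z → Path E x z
  []      ++ q = q
  (e ∷ p) ++ q = e ∷ (p ++ q)

  _∷ʳ_ : ∀ {x y z} → Path E x y → T (E y z) → Path E x z
  p ∷ʳ e = p ++ (e ∷ [])

  vertex : ∀ {x y} (p : Path E x y) → Fin (suc (length p)) → Fin v
  vertex {x} p       zero    = x
  vertex     (_ ∷ p) (suc i) = vertex p i

  prefix : ∀ {x y} (p : Path E x y) i → Path E x (vertex p i)
  prefix p       zero    = []
  prefix (e ∷ p) (suc i) = e ∷ prefix p i

  Acyclic : Set
  Acyclic = ∀ u w → T (E u w) → ¬ Path E w u

  module _ (acyclic : Acyclic) where

    vertex-injective : ∀ {x y} (p : Path E x y) → Injective _≡_ _≡_ (vertex p)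
    vertex-injective []      {zero}  {zero}  _  = refl
    vertex-injective (e ∷ p) {zero}  {zero}  _  = refl
    vertex-injective (e ∷ p) {zero}  {suc j} eq = ⊥-elim (acyclic _ _ e (subst (Path E _) (sym eq) (prefix p j)))
    vertex-injective (e ∷ p) {suc i} {zero}  eq = ⊥-elim (acyclic _ _ e (subst (Path E _) eq (prefix p i)))
    vertex-injective (e ∷ p) {suc i} {suc j} eq = cong suc (vertex-injective p eq)

    length<v : ∀ {x y} (p : Path E x y) → length p < v
    length<v p = injective⇒≤ (vertex-injective p)

  pathWithin? : ∀ k x y → Dec (Σ (Path E x y) λ p → length p ≤ k)
  pathWithin? k x y with x ≟ᶠ y
  ... | yes refl = yes ([] , z≤n)
  pathWithin? zero    x y | no x≢y = no (¬short x≢y)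
    where
    ¬short : ∀ {x y} → x ≢ y → ¬ Σ (Path E x y) λ p → length p ≤ 0
    ¬short x≢y ([]    , _)  = x≢y refl
    ¬short x≢y (_ ∷ _ , ())
  pathWithin? (suc k) x y | no x≢y =
    map′ (λ (w , e , p , short) → e ∷ p , s≤s short) (first-step x≢y)
         (any? λ w → T? (E x w) ×-dec pathWithin? k w y)
    where
    first-step : ∀ {x y} → x ≢ y → Σ (Path E x y) (λ p → length p ≤ suc k) →
                 ∃ λ w → T (E x w) × Σ (Path E w y) λ p → length p ≤ k
    first-step x≢y ([]    , _)        = ⊥-elim (x≢y refl)
    first-step _   (e ∷ p , s≤s short) = _ , e , p , short

  ∷-injective : ∀ {x w w′ y} {e : T (E x w)} {e′ : T (E x w′)} {p : Path E w y} {q : Path E w′ y} →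
                _≡_ {A = Path E x y} (e ∷ p) (e′ ∷ q) → Σ (w ≡ w′) λ { refl → p ≡ q }
  ∷-injective refl = refl , refl

  path? : Acyclic → ∀ x y → Dec (Path E x y)
  path? acyclic x y = map′ proj₁ (λ p → p , <⇒≤ (length<v acyclic p)) (pathWithin? v x y)

module _ {v : ℕ} {E F : Fin v → Fin v → Bool} (F⊆E : ∀ {u w} → T (F u w) → T (E u w)) where

  embed : ∀ {x y} → Path F x y → Path E x y
  embed []      = []
  embed (e ∷ p) = F⊆E e ∷ embed p

  embed-injective : ∀ {x y} {p q : Path F x y} → embed p ≡ embed q → p ≡ q
  embed-injective {p = []}    {[]}    _  = refl
  embed-injective {p = e ∷ p} {f ∷ q} eq with refl , tails ← ∷-injective eq =
    cong₂ _∷_ (T-irrelevant e f) (embed-injective tails)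

-- Blocks of a network for K ⊗ M

⊗-combine : ∀ {m₁ n₁ m₂ n₂} (K : Mat m₁ n₁) (M : Mat m₂ n₂) i i₂ j j₂ →
            (K ⊗ M) (combine i i₂) (combine j j₂) ≡ K i j ∧ M i₂ j₂
⊗-combine K M i i₂ j j₂ =
  cong₂ (λ (i , i₂) (j , j₂) → K i j ∧ M i₂ j₂) (remQuot-combine i i₂) (remQuot-combine j j₂)

module Blocks {m₁ n₁ m₂ n₂} (K : Mat m₁ n₁) (M : Mat m₂ n₂) (N : Network (m₁ * m₂) (n₁ * n₂))
              (N⊨K⊗M : Expresses N (K ⊗ M)) where

  reachedFrom : Fin (v N) → Fin n₁ → Bool
  reachedFrom u j = ⌊ any? (λ j₂ → path? (acyclic N) (inp N (combine j j₂)) u) ⌋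

  reaches : Fin (v N) → Fin m₁ → Bool
  reaches w i = ⌊ any? (λ i₂ → path? (acyclic N) w (out N (combine i i₂))) ⌋

  reachedFrom-sound : ∀ {u j} → T (reachedFrom u j) → ∃ λ j₂ → Path (E N) (inp N (combine j j₂)) u
  reachedFrom-sound = toWitness

  reachedFrom-complete : ∀ {u j j₂} → Path (E N) (inp N (combine j j₂)) u → T (reachedFrom u j)
  reachedFrom-complete p = fromWitness (_ , p)

  reaches-sound : ∀ {w i} → T (reaches w i) → ∃ λ i₂ → Path (E N) w (out N (combine i i₂))
  reaches-sound = toWitness

  reaches-complete : ∀ {w i i₂} → Path (E N) w (out N (combine i i₂)) → T (reaches w i)
  reaches-complete p = fromWitness (_ , p)

  -- non-edges get the empty rectangle
  edgeRect : Fin (v N) → Fin (v N) → (Fin m₁ → Bool) × (Fin n₁ → Bool)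
  edgeRect u w = (λ i → E N u w ∧ reaches w i) , reachedFrom u

  edgeRect-live : ∀ {u w i j} → T (inRect (edgeRect u w) i j) → T (E N u w)
  edgeRect-live = proj₁ ∘ Equivalence.to T-∧ ∘ proj₁ ∘ Equivalence.to T-∧

  edgeRect⊆K : ∀ u w i j → T (inRect (edgeRect u w) i j) → T (K i j)
  edgeRect⊆K u w i j uw∈ij
    with Ruw∋i , u⇜j ← Equivalence.to T-∧ uw∈ij
    with e , w⇝i ← Equivalence.to T-∧ Ruw∋i
    with i₂ , q ← reaches-sound w⇝i | j₂ , p ← reachedFrom-sound u⇜j
    = proj₁ (Equivalence.to T-∧ (subst T (⊗-combine K M i i₂ j j₂) (proj₂ (N⊨K⊗M _ _) (p ++ e ∷ q))))

  block : Fin m₁ → Fin n₁ → Network m₂ n₂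
  block i j = record
    { v        = v N
    ; E        = λ u w → inRect (edgeRect u w) i j
    ; acyclic  = λ u w e p → acyclic N u w (edgeRect-live e) (embed edgeRect-live p)
    ; inp      = λ j₂ → inp N (combine j j₂)
    ; out      = λ i₂ → out N (combine i i₂)
    ; inp-inj  = combine-injectiveʳ j _ j _ ∘ inp-inj N
    ; out-inj  = combine-injectiveʳ i _ i _ ∘ out-inj N
    ; inp-src  = λ j₂ u → cong (λ e → (e ∧ reaches _ i) ∧ reachedFrom u j) (inp-src N (combine j j₂) u)
    ; out-sink = λ i₂ w → cong (λ e → (e ∧ reaches w i) ∧ reachedFrom _ j) (out-sink N (combine i i₂) w)
    }

  block-admissible : ∀ L i j → Admissible L N → Admissible L (block i j)
  block-admissible OR  i j _          = tt
  block-admissible SUM i j unambiguous i₂ j₂ p q =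
    embed-injective edgeRect-live (unambiguous _ _ (embed edgeRect-live p) (embed edgeRect-live q))

  block-expresses : ∀ {i j} → T (K i j) → Expresses (block i j) M
  block-expresses {i} {j} Kij i₂ j₂ =
    restrict [] ∘ proj₁ (N⊨K⊗M _ _) ∘ to-K⊗M , from-K⊗M ∘ proj₂ (N⊨K⊗M _ _) ∘ embed edgeRect-live
    where
    to-K⊗M : T (M i₂ j₂) → T ((K ⊗ M) (combine i i₂) (combine j j₂))
    to-K⊗M Mij = subst T (sym (⊗-combine K M i i₂ j j₂)) (Equivalence.from T-∧ (Kij , Mij))
    from-K⊗M : T ((K ⊗ M) (combine i i₂) (combine j j₂)) → T (M i₂ j₂)
    from-K⊗M = proj₂ ∘ Equivalence.to T-∧ ∘ subst T (⊗-combine K M i i₂ j j₂)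
    -- the part of the path before and after an edge shows that the edge belongs to the block
    restrict : ∀ {x} → Path (E N) (inp N (combine j j₂)) x → Path (E N) x (out N (combine i i₂)) →
               Path (E (block i j)) x (out N (combine i i₂))
    restrict before []          = []
    restrict before (e ∷ after) =
      Equivalence.from T-∧ (Equivalence.from T-∧ (e , reaches-complete after) , reachedFrom-complete before)
      ∷ restrict (before ∷ʳ e) after

IsZero : ∀ {m n} → Mat m n → Set
IsZero A = ∀ i j → ¬ T (A i j)

↑ˡ≢↑ʳ : ∀ {m n} (i : Fin m) (j : Fin n) → i ↑ˡ n ≢ m ↑ʳ j
↑ˡ≢↑ʳ {m} {n} i j eq
  with () ← trans (sym (splitAt-↑ˡ m i n)) (trans (cong (splitAt m) eq) (splitAt-↑ʳ m n j))

edgeless : ∀ m n → Network m n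
edgeless m n = record
  { v        = m + n
  ; E        = λ _ _ → false
  ; acyclic  = λ _ _ ()
  ; inp      = m ↑ʳ_
  ; out      = _↑ˡ n
  ; inp-inj  = ↑ʳ-injective m _ _
  ; out-inj  = ↑ˡ-injective n _ _
  ; inp-src  = λ _ _ → refl
  ; out-sink = λ _ _ → refl
  }

edgeless-no-path : ∀ {m n} i j → ¬ Path (E (edgeless m n)) (inp (edgeless m n) j) (out (edgeless m n) i)
edgeless-no-path i j p = ↑ˡ≢↑ʳ i j (sym (endpoints p))
  where
  endpoints : ∀ {v} {x y : Fin v} → Path (λ _ _ → false) x y → x ≡ y
  endpoints []      = refl
  endpoints (() ∷ _)

zero-complexity : ∀ L {m n} {A : Mat m n} {a} → IsZero A → IsComplexity L A a → a ≡ 0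
zero-complexity L {m} {n} A≡0 (_ , minimal) =
  n≤0⇒n≡0 (≤-trans (minimal (edgeless m n) (admissible L) expresses) (≤-reflexive size≡0))
  where
  admissible : ∀ L → Admissible L (edgeless m n)
  admissible OR  = tt
  admissible SUM i j p = ⊥-elim (edgeless-no-path i j p)
  expresses : Expresses (edgeless m n) _
  expresses i j = ⊥-elim ∘ A≡0 i j , ⊥-elim ∘ edgeless-no-path i j
  size≡0 : size (edgeless m n) ≡ 0
  size≡0 = trans (∑∑count≡card (m + n) (m + n) λ _ _ → false)
                 (card-∅ {(m + n) * (m + n)} (λ _ → false) λ _ ())

zero-rank : ∀ {m n} {K : Mat m n} {r} → IsZero K → IsBoolRank K r → r ≡ 0
zero-rank K≡0 (_ , minimal) = n≤0⇒n≡0 (minimal 0 ((λ ()) , (λ ()) , λ i j Kij → ⊥-elim (K≡0 i j Kij)))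

empty-IsZero : ∀ {m n} → m * n ≡ 0 → (K : Mat m n) → IsZero K
empty-IsZero mn≡0 K i j _ = ¬Fin0 (subst Fin mn≡0 (combine i j))

⊗-IsZero : ∀ {m₁ n₁ m₂ n₂} {K : Mat m₁ n₁} → IsZero K → (M : Mat m₂ n₂) → IsZero (K ⊗ M)
⊗-IsZero K≡0 M i j = K≡0 _ _ ∘ proj₁ ∘ Equivalence.to T-∧

kronecker-cover : ∀ {m₁ n₁ m₂ n₂} (K : Mat m₁ n₁) (M : Mat m₂ n₂) L {a b} →
  IsComplexity L (K ⊗ M) a → IsComplexity L M b → 0 < b → 0 < m₁ * n₁ →
  ∃ λ c → HasRectCover K c × 2 ^ (c * b) ≤ (2 * (m₁ * n₁)) ^ a
kronecker-cover {m₁} {n₁} K M L {b = b} ((N , adm , N⊨K⊗M , refl) , _) (_ , M-minimal) b>0 mn>0 =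
  subst (λ a → ∃ λ c → HasRectCover K c × 2 ^ (c * b) ≤ (2 * (m₁ * n₁)) ^ a)
        (sym (∑∑count≡card (v N) (v N) (E N)))
        (multicover⇒cover K rect live (λ _ _ _ → edgeRect-live) (λ _ → edgeRect⊆K _ _) b>0 multicovered mn>0)
  where
  open Blocks K M N N⊨K⊗M
  rect : Fin (v N * v N) → (Fin m₁ → Bool) × (Fin n₁ → Bool)
  rect = uncurry edgeRect ∘ remQuot (v N)
  live : Fin (v N * v N) → Bool
  live = uncurry (E N) ∘ remQuot (v N)
  multicovered : ∀ i j → T (K i j) → b ≤ card (λ e → inRect (rect e) i j)
  multicovered i j Kij = subst (b ≤_) (∑∑count≡card (v N) (v N) λ u w → inRect (edgeRect u w) i j)
    (M-minimal (block i j) (block-admissible L i j adm) (block-expresses Kij))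

corollary13 : ∀ {m₁ n₁ m₂ n₂} (K : Mat m₁ n₁) (M : Mat m₂ n₂) (L : Measure) (a b r : ℕ) →
    IsComplexity L (K ⊗ M) a → IsComplexity L M b → IsBoolRank K r →
    2 ^ (r * b) ≤ (2 * (m₁ * n₁)) ^ a
corollary13 {m₁} {n₁} K M L a b r K⊗M-opt M-opt rank with m₁ * n₁ ≟ 0 | b ≟ 0
... | yes mn≡0 | _
  with refl ← zero-complexity L (⊗-IsZero (empty-IsZero mn≡0 K) M) K⊗M-opt
     | refl ← zero-rank (empty-IsZero mn≡0 K) rank = ≤-refl
... | no mn≢0 | yes refl rewrite *-zeroʳ r = m^n>0 (2 * (m₁ * n₁)) {{m*n≢0 2 _ {{_}} {{≢-nonZero mn≢0}}}} a
... | no mn≢0 | no b≢0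
  with c , cover , bound ← kronecker-cover K M L K⊗M-opt M-opt (n≢0⇒n>0 b≢0) (n≢0⇒n>0 mn≢0) = begin
  2 ^ (r * b)               ≤⟨ ^-monoʳ-≤ 2 (*-monoˡ-≤ b (proj₂ rank c cover)) ⟩
  2 ^ (c * b)               ≤⟨ bound ⟩
  (2 * (m₁ * n₁)) ^ a       ∎
  where open ≤-Reasoning
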